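{- Let $p$ be an odd prime. Then $$L(p^2+1)=L(p^2-1)=\left(\frac{p-1}{2}\right)\frac{p^2-1}{2}.$$
   Context: For an odd prime $p$ and a positive integer $d$, define $$L(d)=\max_{1\le j\le p-1}\ \sum_{i=j}^{p-1}\left(\left\lfloor\frac{id}{p}\right\rfloor-\left\lfloor\frac{id}{p}-\left(1-\frac1p\right)\frac{jd}{p}\right\rfloor\right).$$ (This is the Booher–Cais lower bound for the $a$-number of a $\mathbb Z/p\mathbb Z$-cover branched at a single point with ramification break $d$.) -}

module Defs where

open import Data.Nat as ℕ using (ℕ; zero; suc; NonZero)
open import Data.Integer as ℤ using (ℤ; +_)
open import Data.Rational as ℚ using (ℚ; floor)
open import Data.List using (List; []; _∷_; map; foldr)
open import Data.List.Base using (applyUpTo)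

-- [ a .. b ] : the list a, a+1, ..., b  (empty if b < a)
range : ℕ → ℕ → List ℕ
range a b = applyUpTo (λ k → a ℕ.+ k) (suc b ℕ.∸ a)

-- maximum of a list of integers (only applied to nonempty lists below)
maxℤ : List ℤ → ℤ
maxℤ []       = + 0
maxℤ (x ∷ xs) = foldr ℤ._⊔_ x xs

sumℤ : List ℤ → ℤ
sumℤ = foldr ℤ._+_ (+ 0)

_/ℚ_ : ℕ → (p : ℕ) → .{{NonZero p}} → ℚ
n /ℚ p = (+ n) ℚ./ p

term : (p : ℕ) → .{{NonZero p}} → (d j i : ℕ) → ℤ
term p d j i =
  floor ((i ℕ.* d) /ℚ p)
  ℤ.- floor ((i ℕ.* d) /ℚ p
             ℚ.- ((ℚ.1ℚ ℚ.- (1 /ℚ p)) ℚ.* ((j ℕ.* d) /ℚ p)))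

L : (p : ℕ) → .{{NonZero p}} → ℕ → ℤ
L p d = maxℤ (map (λ j → sumℤ (map (term p d j) (range j (p ℕ.∸ 1))))
                  (range 1 (p ℕ.∸ 1)))

-- For d = p² ± 1 and 1 ≤ j ≤ i ≤ p - 1 every summand of L(d) equals (p - 1) j.  With
-- w = i p - (p - 1) j one has  i d / p - (1 - 1/p) j d / p = w d / p²,  and since i < p and
-- 1 ≤ w < p² both floors are read off directly: they are i p and w for d = p² + 1, and
-- i p - 1 and w - 1 for d = p² - 1.  Hence the j-th sum is (p - 1) j (p - j), and for
-- p = 2h + 1 the product j (p - j) of two numbers with odd sum p is largest at j = h, where
-- it is h (h + 1); this gives (p - 1) h (h + 1) = ((p - 1)/2) ((p² - 1)/2).

module Submission where

open import Defs
open import Data.Nat using (ℕ; NonZero; _*_; _+_; _∸_; _/_)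
open import Data.Nat.Primality using (Prime)
open import Data.Integer using (+_)
open import Data.Product using (_×_)
open import Relation.Binary.PropositionalEquality using (_≡_; _≢_)

open import Data.Nat using (zero; suc; _≤_; _<_; _≤?_; z≤n; s≤s)
open import Data.Nat.Properties
open import Data.Nat.DivMod using (_%_; m≡m%n+[m/n]*n; m%n<n; m*n/n≡m; m<n⇒m/n≡0; +-distrib-/-∣ˡ; 0/n≡0; /-congˡ; /-congʳ; m*n/o*n≡m/o)
open import Data.Nat.Divisibility using (n∣m*n; divides)
open import Algebra.Properties.CommutativeSemigroup *-commutativeSemigroup using (x∙yz≈y∙xz)
open import Data.Nat.Primality using (composite-≢; composite⇒¬prime; ¬prime[1])
import Data.Nat.Tactic.RingSolver as ℕ-Solver
open import Data.Integer as ℤ using (ℤ; -[1+_])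
open import Data.Integer.Properties using (pos-*; pos-+; m-n≡m⊖n; ⊖-≥; +-injective)
import Data.Integer.Properties as ℤ
open import Data.Integer.DivMod using (div-pos-is-/ℕ)
import Data.Integer.Tactic.RingSolver as ℤ-Solver
open import Data.Rational as ℚ using (ℚ; mkℚ; floor; toℚᵘ)
open import Data.Rational.Properties using (toℚᵘ-fromℚᵘ; toℚᵘ-homo-+; toℚᵘ-homo‿-; toℚᵘ-homo-*)
open import Data.Rational.Unnormalised as ℚᵘ using (mkℚᵘ; *≡*)
open import Data.Rational.Unnormalised.Properties using (≃-refl; ≃-trans; +-cong; -‿cong; *-cong)
open import Data.List using ([]; _∷_; map; length)
open import Data.List.Properties using (length-applyUpTo; foldr-preservesᵇ; foldr-preservesᵒ)
open import Data.List.Membership.Propositional using (_∈_)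
open import Data.List.Membership.Propositional.Properties using (∈-map⁺; ∈-applyUpTo⁺; ∈-applyUpTo⁻)
open import Data.List.Relation.Unary.All as All using (All; _∷_)
import Data.List.Relation.Unary.All.Properties as AllP
open import Data.List.Relation.Unary.Any as Any using (Any; here; there)
open import Data.Product using (∃-syntax; _,_)
open import Function using (_∘_)
open import Data.Sum using (_⊎_; inj₁; inj₂; [_,_])
open import Relation.Nullary using (yes; no; contradiction)
open import Relation.Binary.PropositionalEquality using (refl; sym; trans; cong; cong₂; subst; module ≡-Reasoning)
open ≡-Reasoning

pos-difference : ∀ {m n k} → n + k ≡ m → + m ℤ.- + n ≡ + k
pos-difference {n = n} {k} refl = begin
  + (n + k) ℤ.- + n  ≡⟨ m-n≡m⊖n (n + k) n ⟩
  (n + k) ℤ.⊖ n      ≡⟨ ⊖-≥ (m≤m+n n k) ⟩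
  + (n + k ∸ n)      ≡⟨ cong +_ (m+n∸m≡n n k) ⟩
  + k                ∎

[m*n+o]/n≡m : ∀ m {n o} .{{_ : NonZero n}} → o < n → (m * n + o) / n ≡ m
[m*n+o]/n≡m m {n} {o} o<n = begin
  (m * n + o) / n    ≡⟨ +-distrib-/-∣ˡ o (n∣m*n m) ⟩
  m * n / n + o / n  ≡⟨ cong₂ _+_ (m*n/n≡m m n) (m<n⇒m/n≡0 o<n) ⟩
  m + 0              ≡⟨ +-identityʳ m ⟩
  m                  ∎

[m*n∸o]/n≡m∸1 : ∀ m {n o} .{{_ : NonZero n}} → 0 < o → o ≤ n → (m * n ∸ o) / n ≡ m ∸ 1
[m*n∸o]/n≡m∸1 zero     {n} (s≤s z≤n) _   = 0/n≡0 n
[m*n∸o]/n≡m∸1 (suc m) {n} {o} 0<o o≤n = begin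
  (n + m * n ∸ o) / n  ≡⟨ /-congˡ (trans (+-∸-comm (m * n) o≤n) (+-comm (n ∸ o) (m * n))) ⟩
  (m * n + (n ∸ o)) / n ≡⟨ [m*n+o]/n≡m m (∸-monoʳ-< 0<o o≤n) ⟩
  m                    ∎

floor-≃ : ∀ (x : ℚ) n d .{{_ : NonZero d}} → toℚᵘ x ℚᵘ.≃ (+ n) ℚᵘ./ d → floor x ≡ + (n / d)
floor-≃ (mkℚ (+ m) e _) n (suc k) (*≡* eq) = trans (div-pos-is-/ℕ (+ m) (suc e)) (cong +_ (begin
  m / suc e                        ≡⟨ m*n/o*n≡m/o m (suc k) (suc e) ⟨
  m * suc k / (suc e * suc k)      ≡⟨ cong (_/ (suc e * suc k)) cross ⟩
  n * suc e / (suc e * suc k)      ≡⟨ /-congʳ {m = n * suc e} (*-comm (suc e) (suc k)) ⟩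
  n * suc e / (suc k * suc e)      ≡⟨ m*n/o*n≡m/o n (suc e) (suc k) ⟩
  n / suc k                        ∎))
  where
  cross : m * suc k ≡ n * suc e
  cross = +-injective (begin
    + (m * suc k)      ≡⟨ pos-* m (suc k) ⟩
    + m ℤ.* + suc k    ≡⟨ eq ⟩
    + n ℤ.* + suc e    ≡⟨ pos-* n (suc e) ⟨
    + (n * suc e)      ∎)
floor-≃ (mkℚ -[1+ m ] e _) n (suc k) (*≡* eq) = contradiction (trans eq (sym (pos-* n (suc e)))) λ ()

toℚᵘ-/ℚ : ∀ n p .{{_ : NonZero p}} → toℚᵘ (n /ℚ p) ℚᵘ.≃ (+ n) ℚᵘ./ p
toℚᵘ-/ℚ n (suc q) = toℚᵘ-fromℚᵘ (mkℚᵘ (+ n) q)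

toℚᵘ-homo-− : ∀ x y → toℚᵘ (x ℚ.- y) ℚᵘ.≃ toℚᵘ x ℚᵘ.- toℚᵘ y
toℚᵘ-homo-− x y = ≃-trans (toℚᵘ-homo-+ x (ℚ.- y)) (+-cong (≃-refl {toℚᵘ x}) (toℚᵘ-homo‿- y))

ℚᵘ-shifted-≃ : ∀ q a b c → q * b + c ≡ a * suc q →
  (+ a) ℚᵘ./ suc q ℚᵘ.- (ℚᵘ.1ℚᵘ ℚᵘ.- (+ 1) ℚᵘ./ suc q) ℚᵘ.* ((+ b) ℚᵘ./ suc q)
    ℚᵘ.≃ (+ c) ℚᵘ./ (suc q * suc q)
ℚᵘ-shifted-≃ q a b c eq = *≡* (begin
  (+ a ℤ.* (+ 1 ℤ.* P ℤ.* P) ℤ.+ ℤ.- ((+ 1 ℤ.* P ℤ.+ ℤ.- + 1 ℤ.* + 1) ℤ.* + b) ℤ.* P) ℤ.* (P ℤ.* P)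
    ≡⟨ collect (+ a) (+ b) P ⟩
  (+ a ℤ.* P ℤ.- (P ℤ.- + 1) ℤ.* + b) ℤ.* (P ℤ.* (+ 1 ℤ.* P ℤ.* P))
    ≡⟨ cong (ℤ._* (P ℤ.* (+ 1 ℤ.* P ℤ.* P))) difference ⟩
  + c ℤ.* (P ℤ.* (+ 1 ℤ.* P ℤ.* P))  ∎)
  where
  P = + suc q
  -- the left side is the numerator ℚᵘ computes for the expression, whose denominator is p (1 p p)
  collect : ∀ A B P →
    (A ℤ.* (+ 1 ℤ.* P ℤ.* P) ℤ.+ ℤ.- ((+ 1 ℤ.* P ℤ.+ ℤ.- + 1 ℤ.* + 1) ℤ.* B) ℤ.* P) ℤ.* (P ℤ.* P)
      ≡ (A ℤ.* P ℤ.- (P ℤ.- + 1) ℤ.* B) ℤ.* (P ℤ.* (+ 1 ℤ.* P ℤ.* P))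
  collect = ℤ-Solver.solve-∀
  difference : + a ℤ.* P ℤ.- + q ℤ.* + b ≡ + c
  difference = begin
    + a ℤ.* P ℤ.- + q ℤ.* + b        ≡⟨ cong₂ ℤ._-_ (pos-* a (suc q)) (pos-* q b) ⟨
    + (a * suc q) ℤ.- + (q * b)      ≡⟨ pos-difference eq ⟩
    + c                              ∎

floor-shifted : ∀ q a b c → q * b + c ≡ a * suc q →
  floor ((a /ℚ suc q) ℚ.- ((ℚ.1ℚ ℚ.- (1 /ℚ suc q)) ℚ.* (b /ℚ suc q))) ≡ + (c / (suc q * suc q))
floor-shifted q a b c eq = floor-≃ _ c (suc q * suc q) (≃-trans toℚᵘ-shifted (ℚᵘ-shifted-≃ q a b c eq))
  where
  p = suc q
  toℚᵘ-shifted : toℚᵘ ((a /ℚ p) ℚ.- ((ℚ.1ℚ ℚ.- (1 /ℚ p)) ℚ.* (b /ℚ p)))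
    ℚᵘ.≃ (+ a) ℚᵘ./ p ℚᵘ.- (ℚᵘ.1ℚᵘ ℚᵘ.- (+ 1) ℚᵘ./ p) ℚᵘ.* ((+ b) ℚᵘ./ p)
  toℚᵘ-shifted = ≃-trans (toℚᵘ-homo-− (a /ℚ p) (c₁ ℚ.* (b /ℚ p)))
    (+-cong (toℚᵘ-/ℚ a p) (-‿cong (≃-trans (toℚᵘ-homo-* c₁ (b /ℚ p))
      (*-cong (≃-trans (toℚᵘ-homo-− ℚ.1ℚ (1 /ℚ p)) (+-cong (≃-refl {ℚᵘ.1ℚᵘ}) (-‿cong (toℚᵘ-/ℚ 1 p))))
              (toℚᵘ-/ℚ b p)))))
    where c₁ = ℚ.1ℚ ℚ.- (1 /ℚ p)

term≡[i*d/p]-[w*d/p²] : ∀ q d j i w → w + q * j ≡ i * suc q →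
  term (suc q) d j i ≡ + (i * d / suc q) ℤ.- + (w * d / (suc q * suc q))
term≡[i*d/p]-[w*d/p²] q d j i w eq =
  cong₂ ℤ._-_ (floor-≃ _ (i * d) (suc q) (toℚᵘ-/ℚ (i * d) (suc q)))
              (floor-shifted q (i * d) (j * d) (w * d) scaled)
  where
  scaled : q * (j * d) + w * d ≡ i * d * suc q
  scaled = begin
    q * (j * d) + w * d  ≡⟨ cong (_+ w * d) (*-assoc q j d) ⟨
    q * j * d + w * d    ≡⟨ *-distribʳ-+ d (q * j) w ⟨
    (q * j + w) * d      ≡⟨ cong (_* d) (trans (+-comm (q * j) w) eq) ⟩
    i * suc q * d        ≡⟨ *-assoc i (suc q) d ⟩
    i * (suc q * d)      ≡⟨ cong (i *_) (*-comm (suc q) d) ⟩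
    i * (d * suc q)      ≡⟨ *-assoc i d (suc q) ⟨
    i * d * suc q        ∎

m*[n+1]≡m*n+m : ∀ m n → m * (n + 1) ≡ m * n + m
m*[n+1]≡m*n+m m n = trans (*-distribˡ-+ m n 1) (cong (_+_ (m * n)) (*-identityʳ m))

m*[n∸1]≡m*n∸m : ∀ m n → m * (n ∸ 1) ≡ m * n ∸ m
m*[n∸1]≡m*n∸m m n = trans (*-distribˡ-∸ m n 1) (cong (_∸_ (m * n)) (*-identityʳ m))

module _ {q j i : ℕ} (1≤j : 1 ≤ j) (j≤i : j ≤ i) (i≤q : i ≤ q) where
  private
    p = suc q
    -- w = i p - (p - 1) j, written without truncated subtraction
    w = i + q * (i ∸ j)

    w+qj≡ip : w + q * j ≡ i * p
    w+qj≡ip = begin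
      i + q * (i ∸ j) + q * j    ≡⟨ +-assoc i _ _ ⟩
      i + (q * (i ∸ j) + q * j)  ≡⟨ cong (λ k → i + k) (*-distribˡ-+ q (i ∸ j) j) ⟨
      i + q * (i ∸ j + j)        ≡⟨ cong (λ k → i + q * k) (m∸n+n≡m j≤i) ⟩
      i + q * i                  ≡⟨ cong (λ k → i + k) (*-comm q i) ⟩
      i + i * q                  ≡⟨ *-suc i q ⟨
      i * p                      ∎

    0<i : 0 < i
    0<i = ≤-trans 1≤j j≤i

    0<w : 0 < w
    0<w = ≤-trans 0<i (m≤m+n i _)

    w<p*p : w < p * p
    w<p*p = ≤-<-trans (≤-trans (m≤m+n w (q * j)) (≤-reflexive w+qj≡ip)) (*-monoˡ-< p (s≤s i≤q))

  term-p²+1 : term p (p * p + 1) j i ≡ + (q * j)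
  term-p²+1 = begin
    term p d j i                             ≡⟨ term≡[i*d/p]-[w*d/p²] q d j i w w+qj≡ip ⟩
    + (i * d / p) ℤ.- + (w * d / (p * p))   ≡⟨ cong₂ (λ x y → + x ℤ.- + y) id/p≡ip wd/p²≡w ⟩
    + (i * p) ℤ.- + w                        ≡⟨ pos-difference w+qj≡ip ⟩
    + (q * j)                                ∎
    where
    d = p * p + 1
    id/p≡ip : i * d / p ≡ i * p
    id/p≡ip = trans (/-congˡ (trans (m*[n+1]≡m*n+m i (p * p)) (cong (_+ i) (sym (*-assoc i p p)))))
                    ([m*n+o]/n≡m (i * p) (s≤s i≤q))
    wd/p²≡w : w * d / (p * p) ≡ w
    wd/p²≡w = trans (/-congˡ (m*[n+1]≡m*n+m w (p * p))) ([m*n+o]/n≡m w w<p*p)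

  term-p²-1 : term p (p * p ∸ 1) j i ≡ + (q * j)
  term-p²-1 = begin
    term p d j i                             ≡⟨ term≡[i*d/p]-[w*d/p²] q d j i w w+qj≡ip ⟩
    + (i * d / p) ℤ.- + (w * d / (p * p))   ≡⟨ cong₂ (λ x y → + x ℤ.- + y) id/p≡ip∸1 wd/p²≡w∸1 ⟩
    + (i * p ∸ 1) ℤ.- + (w ∸ 1)              ≡⟨ pos-difference w∸1+qj≡ip∸1 ⟩
    + (q * j)                                ∎
    where
    d = p * p ∸ 1
    id/p≡ip∸1 : i * d / p ≡ i * p ∸ 1
    id/p≡ip∸1 = trans (/-congˡ (trans (m*[n∸1]≡m*n∸m i (p * p)) (cong (_∸ i) (sym (*-assoc i p p)))))
                      ([m*n∸o]/n≡m∸1 (i * p) 0<i (<⇒≤ (s≤s i≤q)))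
    wd/p²≡w∸1 : w * d / (p * p) ≡ w ∸ 1
    wd/p²≡w∸1 = trans (/-congˡ (m*[n∸1]≡m*n∸m w (p * p))) ([m*n∸o]/n≡m∸1 w 0<w (<⇒≤ w<p*p))
    w∸1+qj≡ip∸1 : w ∸ 1 + q * j ≡ i * p ∸ 1
    w∸1+qj≡ip∸1 = trans (sym (+-∸-comm (q * j) 0<w)) (cong (_∸ 1) w+qj≡ip)

m<1+n∸o⇒o+m≤n : ∀ {m n o} → m < suc n ∸ o → o + m ≤ n
m<1+n∸o⇒o+m≤n {m} {n} {o} m<1+n∸o =
  ≤-pred (subst (_≤ suc n) (cong suc (+-comm m o)) (m≤o∸n⇒m+n≤o (suc m) o≤1+n m<1+n∸o))
  where
  o≤1+n : o ≤ suc n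
  o≤1+n = <⇒≤ (m∸n≢0⇒n<m λ eq → contradiction (subst (m <_) eq m<1+n∸o) λ ())

∈-range⁻ : ∀ {a b x} → x ∈ range a b → a ≤ x × x ≤ b
∈-range⁻ {a} x∈ with k , k<n , refl ← ∈-applyUpTo⁻ (_+_ a) x∈ = m≤m+n a k , m<1+n∸o⇒o+m≤n k<n

∈-range⁺ : ∀ {a b x} → a ≤ x → x ≤ b → x ∈ range a b
∈-range⁺ {a} {b} a≤x x≤b =
  subst (_∈ range a b) (m+[n∸m]≡n a≤x) (∈-applyUpTo⁺ (_+_ a) (∸-monoˡ-< (s≤s x≤b) a≤x))

length-range : ∀ a b → length (range a b) ≡ suc b ∸ a
length-range a b = length-applyUpTo (_+_ a) (suc b ∸ a)

sumℤ-map-const : ∀ {A : Set} (f : A → ℤ) {c} xs → (∀ {x} → x ∈ xs → f x ≡ + c) →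
  sumℤ (map f xs) ≡ + (length xs * c)
sumℤ-map-const f []       _     = refl
sumℤ-map-const f {c} (x ∷ xs) const = begin
  f x ℤ.+ sumℤ (map f xs)     ≡⟨ cong₂ ℤ._+_ (const (here refl)) (sumℤ-map-const f xs (const ∘ there)) ⟩
  + c ℤ.+ + (length xs * c)   ≡⟨ pos-+ c (length xs * c) ⟨
  + (c + length xs * c)       ∎

maxℤ-attained : ∀ {M} xs → M ∈ xs → All (ℤ._≤ M) xs → maxℤ xs ≡ M
maxℤ-attained {M} (x ∷ xs) M∈x∷xs (x≤M ∷ xs≤M) = ℤ.≤-antisym
  (foldr-preservesᵇ ℤ.⊔-lub x≤M xs≤M)
  (foldr-preservesᵒ (λ y z → [ ℤ.i≤j⇒i≤j⊔k z , ℤ.i≤j⇒i≤k⊔j y ]) x xs (bounded M∈x∷xs))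
  where
  bounded : M ∈ x ∷ xs → M ℤ.≤ x ⊎ Any (M ℤ.≤_) xs
  bounded (here M≡x)  = inj₁ (ℤ.≤-reflexive M≡x)
  bounded (there M∈xs) = inj₂ (Any.map ℤ.≤-reflexive M∈xs)

m*n+t*[1+t]≡[m+t]*[1+m+t] : ∀ m t n → m + n ≡ suc ((m + t) + (m + t)) →
  m * n + t * suc t ≡ (m + t) * suc (m + t)
m*n+t*[1+t]≡[m+t]*[1+m+t] m t n eq =
  subst (λ n → m * n + t * suc t ≡ (m + t) * suc (m + t)) (sym n≡1+m+2t) (expand m t)
  where
  split : ∀ m t → suc ((m + t) + (m + t)) ≡ m + suc (t + (m + t))
  split = ℕ-Solver.solve-∀
  n≡1+m+2t : n ≡ suc (t + (m + t))
  n≡1+m+2t = +-cancelˡ-≡ m n (suc (t + (m + t))) (trans eq (split m t))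
  expand : ∀ m t → m * suc (t + (m + t)) + t * suc t ≡ (m + t) * suc (m + t)
  expand = ℕ-Solver.solve-∀

m≤h∧m+n≡1+2h⇒m*n≤h*[1+h] : ∀ {m n h} → m ≤ h → m + n ≡ suc (h + h) → m * n ≤ h * suc h
m≤h∧m+n≡1+2h⇒m*n≤h*[1+h] {m} {n} m≤h eq with t , refl ← m≤n⇒∃[o]m+o≡n m≤h =
  subst (m * n ≤_) (m*n+t*[1+t]≡[m+t]*[1+m+t] m t n eq) (m≤m+n (m * n) (t * suc t))

m+n≡1+2h⇒m*n≤h*[1+h] : ∀ m n h → m + n ≡ suc (h + h) → m * n ≤ h * suc h
m+n≡1+2h⇒m*n≤h*[1+h] m n h eq with m ≤? h
... | yes m≤h = m≤h∧m+n≡1+2h⇒m*n≤h*[1+h] m≤h eq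
... | no  m≰h = subst (_≤ h * suc h) (*-comm n m) (m≤h∧m+n≡1+2h⇒m*n≤h*[1+h] n≤h (trans (+-comm n m) eq))
  where
  n≤h : n ≤ h
  n≤h = +-cancelˡ-≤ (suc h) n h (subst (suc h + n ≤_) eq (+-monoˡ-≤ n (≰⇒> m≰h)))

L≡2h*h*[1+h] : ∀ h d → 0 < h →
  (∀ {j i} → 1 ≤ j → j ≤ i → i ≤ h + h → term (suc (h + h)) d j i ≡ + ((h + h) * j)) →
  L (suc (h + h)) d ≡ + ((h + h) * (h * suc h))
L≡2h*h*[1+h] h d 0<h term-const = maxℤ-attained (map column (range 1 q))
  (subst (_∈ map column (range 1 q)) column-at-h (∈-map⁺ column (∈-range⁺ 0<h h≤q)))
  (AllP.map⁺ (All.tabulate (column-bounded ∘ ∈-range⁻)))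
  where
  q = h + h
  h≤q : h ≤ q
  h≤q = m≤m+n h h
  column : ℕ → ℤ
  column j = sumℤ (map (term (suc q) d j) (range j q))
  column-value : ∀ {j} → 1 ≤ j → j ≤ q → column j ≡ + (q * ((suc q ∸ j) * j))
  column-value {j} 1≤j j≤q = begin
    column j                          ≡⟨ sumℤ-map-const (term (suc q) d j) (range j q) const ⟩
    + (length (range j q) * (q * j))  ≡⟨ cong (λ n → + (n * (q * j))) (length-range j q) ⟩
    + ((suc q ∸ j) * (q * j))         ≡⟨ cong +_ (x∙yz≈y∙xz (suc q ∸ j) q j) ⟩
    + (q * ((suc q ∸ j) * j))         ∎
    where
    const : ∀ {i} → i ∈ range j q → term (suc q) d j i ≡ + (q * j)
    const i∈ = let j≤i , i≤q = ∈-range⁻ i∈ in term-const 1≤j j≤i i≤q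
  column-bounded : ∀ {j} → 1 ≤ j × j ≤ q → column j ℤ.≤ + (q * (h * suc h))
  column-bounded {j} (1≤j , j≤q) = subst (ℤ._≤ _) (sym (column-value 1≤j j≤q))
    (ℤ.+≤+ (*-monoʳ-≤ q (m+n≡1+2h⇒m*n≤h*[1+h] (suc q ∸ j) j h (m∸n+n≡m (m≤n⇒m≤1+n j≤q)))))
  column-at-h : column h ≡ + (q * (h * suc h))
  column-at-h = trans (column-value 0<h h≤q) (cong (λ n → + (q * n)) (begin
    (suc q ∸ h) * h   ≡⟨ cong (λ n → (n ∸ h) * h) (+-suc h h) ⟨
    (h + suc h ∸ h) * h ≡⟨ cong (_* h) (m+n∸m≡n h (suc h)) ⟩
    suc h * h         ≡⟨ *-comm (suc h) h ⟩
    h * suc h         ∎))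

h+h≡h*2 : ∀ h → h + h ≡ h * 2
h+h≡h*2 h = trans (cong (_+_ h) (sym (+-identityʳ h))) (*-comm 2 h)

prime≢2⇒odd : ∀ {p} .{{_ : NonZero p}} → Prime p → p ≢ 2 → ∃[ h ] 0 < h × p ≡ suc (h + h)
prime≢2⇒odd {p} pr p≢2 with p / 2 | p % 2 | m%n<n p 2 | m≡m%n+[m/n]*n p 2
... | h     | 0           | _                   | p≡h*2 =
  contradiction pr (composite⇒¬prime (composite-≢ 2 (p≢2 ∘ sym) (divides h p≡h*2)))
... | 0     | 1           | _                   | refl = contradiction pr ¬prime[1]
... | suc h | 1           | _                   | p≡1+h*2 =
  suc h , s≤s z≤n , trans p≡1+h*2 (cong suc (sym (h+h≡h*2 (suc h))))
... | _     | suc (suc _) | s≤s (s≤s ())        | _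

[p∸1]/2*[p²∸1]/2≡2h*h*[1+h] : ∀ h →
  ((suc (h + h) ∸ 1) / 2) * ((suc (h + h) * suc (h + h) ∸ 1) / 2) ≡ (h + h) * (h * suc h)
[p∸1]/2*[p²∸1]/2≡2h*h*[1+h] h = begin
  ((h + h) / 2) * ((q + q * suc q) / 2)   ≡⟨ cong₂ (λ x y → x / 2 * (y / 2)) (h+h≡h*2 h) (factor h) ⟩
  (h * 2 / 2) * (q * suc h * 2 / 2)       ≡⟨ cong₂ _*_ (m*n/n≡m h 2) (m*n/n≡m (q * suc h) 2) ⟩
  h * (q * suc h)                         ≡⟨ x∙yz≈y∙xz h q (suc h) ⟩
  q * (h * suc h)                         ∎
  where
  q = h + h
  factor : ∀ h → (h + h) + (h + h) * suc (h + h) ≡ (h + h) * suc h * 2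
  factor = ℕ-Solver.solve-∀

lemma2p3 : (p : ℕ) → .{{_ : NonZero p}} → Prime p → p ≢ 2 →
    (L p (p * p + 1) ≡ + (((p ∸ 1) / 2) * ((p * p ∸ 1) / 2)))
    × (L p (p * p ∸ 1) ≡ + (((p ∸ 1) / 2) * ((p * p ∸ 1) / 2)))
lemma2p3 p pr p≢2 with prime≢2⇒odd pr p≢2
... | h , 0<h , refl =
  trans (L≡2h*h*[1+h] h _ 0<h term-p²+1) answer ,
  trans (L≡2h*h*[1+h] h _ 0<h term-p²-1) answer
  where
  answer : + ((h + h) * (h * suc h)) ≡ + (((p ∸ 1) / 2) * ((p * p ∸ 1) / 2))
  answer = cong +_ (sym ([p∸1]/2*[p²∸1]/2≡2h*h*[1+h] h))
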